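{- Let $Q$ be an involutive residuated lattice with unit $1$, cyclic dualizing element $0$, and negation $x^{*} := x\backslash 0 = 0/x$. Then an element $f \in Q$ is dualizing (i.e. $f/(x\backslash f) = (f/x)\backslash f = x$ for all $x\in Q$) if and only if $f^{*}$ is invertible (i.e. there is $g\in Q$ with $f^{*}\circ g = g\circ f^{*} = 1$).
   Context: A residuated lattice is a lattice $Q$ with a monoid structure $(Q,\circ,1)$ and binary operations $\backslash,/$ such that $a\circ c\le b\iff c\le a\backslash b\iff a\le b/c$. It is involutive if it has an element $0$ that is cyclic ($x\backslash 0 = 0/x$ for all $x$) and dualizing ($0/(x\backslash 0) = (0/x)\backslash 0 = x$ for all $x$); then $x^{*}:=x\backslash 0=0/x$ satisfies $x^{**}=x$. -}

module Defs where

open import Level using (Level; _⊔_) renaming (suc to lsuc)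
open import Data.Product using (_×_; Σ-syntax)
open import Function.Bundles using (_⇔_)
open import Relation.Binary.Core using (Rel)
open import Algebra.Core using (Op₂)
open import Relation.Binary.Lattice.Structures using (IsLattice)
open import Algebra.Structures using (IsMonoid)

record ResiduatedLattice (c ℓ₁ ℓ₂ : Level) : Set (lsuc (c ⊔ ℓ₁ ⊔ ℓ₂)) where
  infix  4 _≈_ _≤_
  infixr 6 _∨_
  infixr 7 _∧_
  infixl 8 _∘_
  infixr 9 _＼_
  infixl 9 _／_
  field
    Carrier   : Set c
    _≈_       : Rel Carrier ℓ₁
    _≤_       : Rel Carrier ℓ₂
    _∨_       : Op₂ Carrier
    _∧_       : Op₂ Carrier
    _∘_       : Op₂ Carrier
    𝟙         : Carrier
    _＼_      : Op₂ Carrier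
    _／_      : Op₂ Carrier
    isLattice : IsLattice _≈_ _≤_ _∨_ _∧_
    isMonoid  : IsMonoid _≈_ _∘_ 𝟙
    resˡ      : ∀ a b c → (a ∘ c ≤ b) ⇔ (c ≤ a ＼ b)
    resʳ      : ∀ a b c → (a ∘ c ≤ b) ⇔ (a ≤ b ／ c)

record InvolutiveResiduatedLattice (c ℓ₁ ℓ₂ : Level) : Set (lsuc (c ⊔ ℓ₁ ⊔ ℓ₂)) where
  field
    residuatedLattice : ResiduatedLattice c ℓ₁ ℓ₂
  open ResiduatedLattice residuatedLattice public
  field
    𝟘          : Carrier
    cyclic     : ∀ x → (x ＼ 𝟘) ≈ (𝟘 ／ x)
    dualizing𝟘 : ∀ x → ((𝟘 ／ (x ＼ 𝟘)) ≈ x) × (((𝟘 ／ x) ＼ 𝟘) ≈ x)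

  _* : Carrier → Carrier
  x * = x ＼ 𝟘

  IsDualizing : Carrier → Set (c ⊔ ℓ₁)
  IsDualizing f = ∀ x → ((f ／ (x ＼ f)) ≈ x) × (((f ／ x) ＼ f) ≈ x)

  IsInvertible : Carrier → Set (c ⊔ ℓ₁)
  IsInvertible a = Σ[ g ∈ Carrier ] ((a ∘ g) ≈ 𝟙 × (g ∘ a) ≈ 𝟙)

module Submission where

open import Defs
open import Level using (Level)
open import Function.Base using (flip)
open import Function.Bundles using (_⇔_; mk⇔; Equivalence)
open import Data.Product using (_,_; proj₁; proj₂; swap)
open import Relation.Binary.Bundles using (Poset)
open import Relation.Binary.Lattice.Structures using (IsLattice)
open import Relation.Binary.Structures using (IsPartialOrder)
open import Algebra.Bundles using (Monoid)
open import Algebra.Structures using (IsMonoid)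
import Algebra.Construct.Flip.Op as Flip
import Algebra.Properties.Monoid as MonoidProperties
import Relation.Binary.Reasoning.PartialOrder as PosetReasoning

-- Over Q, c ≤ x holds iff c ∘ x* ≤ 0 iff x* ∘ c ≤ 0, because 0 is dualizing.
-- If f is dualizing, these tests show that f/0 is a right inverse of f*
-- and 0\f a left inverse. Conversely, if g ∘ f* = 1 then x* ≤ (x\f) ∘ f*,
-- which by the same test forces f/(x\f) ≤ x. Every argument is one-sided:
-- the other half is the same argument in the opposite lattice, which
-- reverses ∘ and exchanges \ with /.

opposite : ∀ {o ℓ₁ ℓ₂} → InvolutiveResiduatedLattice o ℓ₁ ℓ₂ →
           InvolutiveResiduatedLattice o ℓ₁ ℓ₂
opposite Q = record
  { residuatedLattice = record
    { Carrier   = Carrier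
    ; _≈_       = _≈_
    ; _≤_       = _≤_
    ; _∨_       = _∨_
    ; _∧_       = _∧_
    ; _∘_       = flip _∘_
    ; 𝟙         = 𝟙
    ; _＼_      = flip _／_
    ; _／_      = flip _＼_
    ; isLattice = isLattice
    ; isMonoid  = Flip.isMonoid isMonoid
    ; resˡ      = λ a b c → resʳ c b a
    ; resʳ      = λ a b c → resˡ c b a
    }
  ; 𝟘          = 𝟘
  ; cyclic     = λ x → IsMonoid.sym isMonoid (cyclic x)
  ; dualizing𝟘 = λ x → swap (dualizing𝟘 x)
  }
  where open InvolutiveResiduatedLattice Q

module Properties {o ℓ₁ ℓ₂ : Level} (Q : InvolutiveResiduatedLattice o ℓ₁ ℓ₂) where
  open InvolutiveResiduatedLattice Q
  open IsLattice isLattice using (isPartialOrder)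
  open IsPartialOrder isPartialOrder using (antisym; reflexive) renaming (refl to ≤-refl; trans to ≤-trans)
  open IsMonoid isMonoid using (assoc; identityˡ; ∙-congˡ; ∙-congʳ; sym; trans)

  poset : Poset o ℓ₁ ℓ₂
  poset = record { isPartialOrder = isPartialOrder }

  monoid : Monoid o ℓ₁
  monoid = record { isMonoid = isMonoid }

  open PosetReasoning poset
  open MonoidProperties monoid using (cancelˡ; cancelʳ; elimʳ)

  ＼-intro : ∀ {a b c} → a ∘ c ≤ b → c ≤ a ＼ b
  ＼-intro {a} {b} {c} = Equivalence.to (resˡ a b c)

  ＼-elim : ∀ {a b c} → c ≤ a ＼ b → a ∘ c ≤ b
  ＼-elim {a} {b} {c} = Equivalence.from (resˡ a b c)

  ／-intro : ∀ {a b c} → a ∘ c ≤ b → a ≤ b ／ c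
  ／-intro {a} {b} {c} = Equivalence.to (resʳ a b c)

  ／-elim : ∀ {a b c} → a ≤ b ／ c → a ∘ c ≤ b
  ／-elim {a} {b} {c} = Equivalence.from (resʳ a b c)

  ∘＼≤ : ∀ {a b} → a ∘ (a ＼ b) ≤ b
  ∘＼≤ = ＼-elim ≤-refl

  ／∘≤ : ∀ {a b} → (b ／ a) ∘ a ≤ b
  ／∘≤ = ／-elim ≤-refl

  ∘-monoˡ-≤ : ∀ {x y z} → x ≤ y → x ∘ z ≤ y ∘ z
  ∘-monoˡ-≤ x≤y = ／-elim (≤-trans x≤y (／-intro ≤-refl))

  ∘-monoʳ-≤ : ∀ {x y z} → x ≤ y → z ∘ x ≤ z ∘ y
  ∘-monoʳ-≤ x≤y = ＼-elim (≤-trans x≤y (＼-intro ≤-refl))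

  *∘≤𝟘 : ∀ {x} → x * ∘ x ≤ 𝟘
  *∘≤𝟘 {x} = begin
    x * ∘ x    ≈⟨ ∙-congʳ (cyclic x) ⟩
    𝟘 ／ x ∘ x ≤⟨ ／∘≤ ⟩
    𝟘          ∎

  ∘*≤𝟘⇒≤ : ∀ {c x} → c ∘ x * ≤ 𝟘 → c ≤ x
  ∘*≤𝟘⇒≤ {c} {x} c∘x*≤𝟘 = begin
    c              ≤⟨ ／-intro c∘x*≤𝟘 ⟩
    𝟘 ／ (x ＼ 𝟘)   ≈⟨ proj₁ (dualizing𝟘 x) ⟩
    x              ∎

  *∘≤𝟘⇒≤ : ∀ {c x} → x * ∘ c ≤ 𝟘 → c ≤ x
  *∘≤𝟘⇒≤ {c} {x} x*∘c≤𝟘 = begin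
    c              ≤⟨ ＼-intro (≤-trans (∘-monoˡ-≤ (reflexive (sym (cyclic x)))) x*∘c≤𝟘) ⟩
    (𝟘 ／ x) ＼ 𝟘   ≈⟨ proj₂ (dualizing𝟘 x) ⟩
    x              ∎

  𝟙*≤𝟘 : 𝟙 * ≤ 𝟘
  𝟙*≤𝟘 = begin
    𝟙 ＼ 𝟘        ≈⟨ identityˡ (𝟙 ＼ 𝟘) ⟨
    𝟙 ∘ (𝟙 ＼ 𝟘)  ≤⟨ ∘＼≤ ⟩
    𝟘            ∎

  ∘𝟘≤𝟘⇒≤𝟙 : ∀ {c} → c ∘ 𝟘 ≤ 𝟘 → c ≤ 𝟙
  ∘𝟘≤𝟘⇒≤𝟙 c∘𝟘≤𝟘 = ∘*≤𝟘⇒≤ (≤-trans (∘-monoʳ-≤ 𝟙*≤𝟘) c∘𝟘≤𝟘)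

  *≤𝟘⇒𝟙≤ : ∀ {x} → x * ≤ 𝟘 → 𝟙 ≤ x
  *≤𝟘⇒𝟙≤ {x} x*≤𝟘 = ∘*≤𝟘⇒≤ (≤-trans (reflexive (identityˡ (x *))) x*≤𝟘)

  inverses⇒invertible : ∀ {a g g′} → a ∘ g ≈ 𝟙 → g′ ∘ a ≈ 𝟙 → IsInvertible a
  inverses⇒invertible {a} {g} {g′} a∘g≈𝟙 g′∘a≈𝟙 = g , a∘g≈𝟙 , trans (∙-congʳ g≈g′) g′∘a≈𝟙
    where
    g≈g′ : g ≈ g′
    g≈g′ = trans (sym (cancelˡ g′∘a≈𝟙 g)) (elimʳ a∘g≈𝟙 g′)

  *∘／𝟘≈𝟙 : ∀ {f} → (f ／ 𝟘) ＼ f ≤ 𝟘 → f * ∘ (f ／ 𝟘) ≈ 𝟙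
  *∘／𝟘≈𝟙 {f} [f／𝟘]＼f≤𝟘 = antisym (∘𝟘≤𝟘⇒≤𝟙 upper) (*≤𝟘⇒𝟙≤ lower)
    where
    z : Carrier
    z = f * ∘ (f ／ 𝟘)

    upper : z ∘ 𝟘 ≤ 𝟘
    upper = begin
      z ∘ 𝟘                 ≈⟨ assoc (f *) (f ／ 𝟘) 𝟘 ⟩
      f * ∘ ((f ／ 𝟘) ∘ 𝟘)   ≤⟨ ∘-monoʳ-≤ ／∘≤ ⟩
      f * ∘ f               ≤⟨ *∘≤𝟘 ⟩
      𝟘                     ∎

    f*∘[f／𝟘]∘z*≤𝟘 : f * ∘ ((f ／ 𝟘) ∘ z *) ≤ 𝟘
    f*∘[f／𝟘]∘z*≤𝟘 = begin
      f * ∘ ((f ／ 𝟘) ∘ z *)  ≈⟨ assoc (f *) (f ／ 𝟘) (z *) ⟨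
      z ∘ z *               ≤⟨ ∘＼≤ ⟩
      𝟘                     ∎

    lower : z * ≤ 𝟘
    lower = ≤-trans (＼-intro (*∘≤𝟘⇒≤ f*∘[f／𝟘]∘z*≤𝟘)) [f／𝟘]＼f≤𝟘

  ／＼-cancel : ∀ {f g} → g ∘ f * ≈ 𝟙 → ∀ x → f ／ (x ＼ f) ≈ x
  ／＼-cancel {f} {g} g∘f*≈𝟙 x = antisym (∘*≤𝟘⇒≤ c∘x*≤𝟘) (／-intro ∘＼≤)
    where
    c : Carrier
    c = f ／ (x ＼ f)

    𝟘∘g≤f : 𝟘 ∘ g ≤ f
    𝟘∘g≤f = ∘*≤𝟘⇒≤ (begin
      𝟘 ∘ g ∘ f *    ≈⟨ assoc 𝟘 g (f *) ⟩
      𝟘 ∘ (g ∘ f *)  ≈⟨ elimʳ g∘f*≈𝟙 𝟘 ⟩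
      𝟘              ∎)

    x*∘g≤x＼f : x * ∘ g ≤ x ＼ f
    x*∘g≤x＼f = ＼-intro (begin
      x ∘ (x * ∘ g)  ≈⟨ assoc x (x *) g ⟨
      x ∘ x * ∘ g    ≤⟨ ∘-monoˡ-≤ ∘＼≤ ⟩
      𝟘 ∘ g          ≤⟨ 𝟘∘g≤f ⟩
      f              ∎)

    c∘x*≤𝟘 : c ∘ x * ≤ 𝟘
    c∘x*≤𝟘 = begin
      c ∘ x *                ≈⟨ ∙-congˡ (cancelʳ g∘f*≈𝟙 (x *)) ⟨
      c ∘ (x * ∘ g ∘ f *)    ≤⟨ ∘-monoʳ-≤ (∘-monoˡ-≤ x*∘g≤x＼f) ⟩
      c ∘ ((x ＼ f) ∘ f *)   ≈⟨ assoc c (x ＼ f) (f *) ⟨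
      c ∘ (x ＼ f) ∘ f *     ≤⟨ ∘-monoˡ-≤ ／∘≤ ⟩
      f ∘ f *                ≤⟨ ∘＼≤ ⟩
      𝟘                      ∎

module _ {o ℓ₁ ℓ₂ : Level} (Q : InvolutiveResiduatedLattice o ℓ₁ ℓ₂) where
  open InvolutiveResiduatedLattice Q
  open IsLattice isLattice using (reflexive)
  open IsMonoid isMonoid using (∙-congˡ; ∙-congʳ; sym; trans)
  open Properties Q
  private module Op = Properties (opposite Q)

  dualizing⇒*-invertible : ∀ {f} → IsDualizing f → IsInvertible (f *)
  dualizing⇒*-invertible {f} f-dualizing =
    inverses⇒invertible
      (*∘／𝟘≈𝟙 (reflexive (proj₂ (f-dualizing 𝟘))))
      (trans (∙-congˡ (cyclic f)) (Op.*∘／𝟘≈𝟙 (reflexive (proj₁ (f-dualizing 𝟘)))))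

  *-invertible⇒dualizing : ∀ {f} → IsInvertible (f *) → IsDualizing f
  *-invertible⇒dualizing {f} (g , f*∘g≈𝟙 , g∘f*≈𝟙) x =
    ／＼-cancel g∘f*≈𝟙 x , Op.／＼-cancel (trans (∙-congʳ (sym (cyclic f))) f*∘g≈𝟙) x

mainTheorem11 : ∀ {c ℓ₁ ℓ₂ : Level} (Q : InvolutiveResiduatedLattice c ℓ₁ ℓ₂) →
    let open InvolutiveResiduatedLattice Q in
      ∀ (f : Carrier) → IsDualizing f ⇔ IsInvertible (f *)
mainTheorem11 Q f = mk⇔ (dualizing⇒*-invertible Q) (*-invertible⇒dualizing Q)
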